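{- Let $(G,\sigma)$ be a connected un2qBMG explained by the tree $(T,\sigma,u)$. If $(T,\sigma,u)$ is least-resolved, then for every internal vertex $v$ of $T$ there exists an edge $xy\in E(G)$ such that $v=\mathrm{lca}_T(x,y)$.
   Context: All trees are rooted (root $\rho$) and phylogenetic (every non-leaf vertex has at least two children); $L(T)$ is the leaf set; internal vertices are non-leaves; $a\preceq b$ means $a$ is a descendant of or equal to $b$; $\mathrm{lca}$ is the last common ancestor. A un2qBMG is the underlying undirected graph of a 2-colored quasi-best match graph; equivalently (as shown in the paper), a vertex-colored graph explained by some tree in the following sense. A tree $(T,\sigma,u)$ with $\sigma$ a leaf-coloring into two colors and $u$ a map on leaves with $u(x)\in\{x,\rho\}$ explains $(G,\sigma)$ if $V(G)=L(T)$ and for leaves $x,y$: $xy\in E(G)$ iff $\sigma(x)\neq\sigma(y)$ and either (a) $u(x)\neq x$ and $y\preceq\mathrm{lca}(x,z)$ for all leaves $z$ with $\sigma(z)=\sigma(y)$, or (b) $u(y)\neq y$ and $x\preceq\mathrm{lca}(y,z)$ for all leaves $z$ with $\sigma(z)=\sigma(x)$. A tree $(T,\sigma,u)$ explaining $G$ is least-resolved if there is no tree $(T',\sigma,u')$ explaining $G$ such that $T'$ is obtained from $T$ by a (nonempty) sequence of contractions of internal arcs. -}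

module Defs where

open import Data.Nat using (ℕ; _≤_)
open import Data.Fin using (Fin)
open import Data.Bool using (Bool; true)
open import Data.List using (List; []; _∷_; _++_; length; lookup; allFin)
open import Data.List.Relation.Unary.All using (All)
open import Data.List.Relation.Binary.Permutation.Propositional using (_↭_)
open import Data.Product using (Σ; _×_; ∃; ∃-syntax)
open import Data.Sum using (_⊎_)
open import Relation.Binary.PropositionalEquality using (_≡_; _≢_)
open import Relation.Binary.Construct.Closure.ReflexiveTransitive using (Star)
open import Relation.Binary.Construct.Closure.Transitive using (TransClosure)
open import Relation.Nullary using (¬_)

-- Rooted trees whose leaves are labelled by elements of Fin n.
-- A vertex of the tree is a position (path from the root ρ).

module _ {n : ℕ} where

  data Tree : Set where
    leaf : Fin n → Tree
    node : List Tree → Tree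

  mutual
    leaves : Tree → List (Fin n)
    leaves (leaf x)  = x ∷ []
    leaves (node ts) = leavesL ts

    leavesL : List Tree → List (Fin n)
    leavesL []       = []
    leavesL (t ∷ ts) = leaves t ++ leavesL ts

  data Phylo : Tree → Set where
    leafP : ∀ {x} → Phylo (leaf x)
    nodeP : ∀ {ts} → 2 ≤ length ts → All Phylo ts → Phylo (node ts)

  LeafSetIs : Tree → Set
  LeafSetIs t = leaves t ↭ allFin n

  IsNode : Tree → Set
  IsNode t = Σ (List Tree) (λ ts → t ≡ node ts)

  data Pos : Tree → Set where
    root : ∀ {t} → Pos t
    down : ∀ {ts} (i : Fin (length ts)) → Pos (lookup ts i) → Pos (node ts)

  sub : (t : Tree) → Pos t → Tree
  sub t root = t
  sub (node ts) (down i p) = sub (lookup ts i) p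

  data _⪯_ : ∀ {t} → Pos t → Pos t → Set where
    ⪯root : ∀ {t} {a : Pos t} → a ⪯ root
    ⪯down : ∀ {ts i} {a b : Pos (lookup ts i)} → a ⪯ b → down {ts} i a ⪯ down i b

  LeafBelow : (t : Tree) → Fin n → Pos t → Set
  LeafBelow t x v = ∃[ p ] (sub t p ≡ leaf x × p ⪯ v)

  IsLca : (t : Tree) → Fin n → Fin n → Pos t → Set
  IsLca t x y v = LeafBelow t x v × LeafBelow t y v
                × (∀ w → LeafBelow t x w → LeafBelow t y w → v ⪯ w)

  -- u : leaves → {x, ρ}, encoded as Bool: u x ≡ true means u(x) = ρ.
  -- u(x) ≠ x  iff  u(x) = ρ and ρ ≠ x (i.e. the root is not the leaf x).
  UNotSelf : Tree → (Fin n → Bool) → Fin n → Set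
  UNotSelf t u x = u x ≡ true × IsNode t

  CondA : Tree → (Fin n → Bool) → (Fin n → Bool) → Fin n → Fin n → Set
  CondA t σ u x y = UNotSelf t u x
                  × (∀ z → σ z ≡ σ y → ∃[ v ] (IsLca t x z v × LeafBelow t y v))

  -- (T, σ, u) explains (G, σ), G given by its edge relation E on V(G) = Fin n
  Explains : Tree → (Fin n → Bool) → (Fin n → Bool) → (Fin n → Fin n → Set) → Set
  Explains t σ u E = ∀ x y →
    (E x y → (σ x ≢ σ y × (CondA t σ u x y ⊎ CondA t σ u y x)))
    × ((σ x ≢ σ y × (CondA t σ u x y ⊎ CondA t σ u y x)) → E x y)

  -- Contraction of an internal arc (v, w), w an inner vertex:
  -- the children of w become children of v.
  data Splice : List Tree → List Tree → Set where
    spliceHere  : ∀ {cs ts} → Splice (node cs ∷ ts) (cs ++ ts)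
    spliceThere : ∀ {t ts ts'} → Splice ts ts' → Splice (t ∷ ts) (t ∷ ts')

  mutual
    data Contract1 : Tree → Tree → Set where
      contrHere : ∀ {ts ts'} → Splice ts ts' → Contract1 (node ts) (node ts')
      contrDeep : ∀ {ts ts'} → ContractIn ts ts' → Contract1 (node ts) (node ts')

    data ContractIn : List Tree → List Tree → Set where
      inHere  : ∀ {t t' ts} → Contract1 t t' → ContractIn (t ∷ ts) (t' ∷ ts)
      inThere : ∀ {t ts ts'} → ContractIn ts ts' → ContractIn (t ∷ ts) (t ∷ ts')

  Contract⁺ : Tree → Tree → Set
  Contract⁺ = TransClosure Contract1

  LeastResolved : Tree → (Fin n → Bool) → (Fin n → Fin n → Set) → Set
  LeastResolved t σ E =
    ¬ (∃[ t' ] ∃[ u' ] (Contract⁺ t t' × Explains t' σ u' E))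

  Connected : (Fin n → Fin n → Set) → Set
  Connected E = ∀ x y → Star E x y

-- A tree with no edge whose lca is the inner vertex v is never least resolved. At the root ρ this is
-- immediate: ρ has at least two children, and a path of the connected graph G from a leaf below the
-- first child to a leaf below the second leaves the first child along an edge xy, so lca(x, y) = ρ.
-- For v ≠ ρ, contract the arc into v. The clusters L(T(w)) of the contracted tree are those of T
-- except L(T(v)), and condition (a) for (x, y) only asks that y lie in every cluster containing x and
-- any z of y's colour. So the contraction explains G as well, unless some cluster condition at v
-- fails; but then x and a leaf z of y's colour below v are adjacent with lca(x, z) = v. Since the
-- existence of such an edge is decidable, the contradiction produces one.

module Submission where

open import Defs
open import Data.Nat using (ℕ; s≤s)
open import Data.Fin using (Fin; zero; suc) renaming (_≟_ to _≟ᶠ_)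
open import Data.Fin.Properties using (any?; all?; 0≢1+n)
open import Data.Bool using (Bool; true)
open import Data.Bool.Properties using () renaming (_≟_ to _≟ᵇ_)
open import Data.List using (List; []; _∷_; _++_; length; lookup; allFin)
open import Data.List.Properties using (++-assoc)
open import Data.List.Membership.Propositional using (_∈_; _∉_)
open import Data.List.Membership.Propositional.Properties using (∈-++⁺ˡ; ∈-++⁺ʳ; ∈-++⁻; ∈-allFin)
import Data.List.Membership.DecPropositional as DecMembership
open import Data.List.Relation.Unary.Any using (here; there)
open import Data.List.Relation.Unary.All as All using ([]; _∷_)
open import Data.List.Relation.Unary.All.Properties using (++⁻ˡ; ++⁻ʳ)
open import Data.List.Relation.Unary.AllPairs using ([]; _∷_)
open import Data.List.Relation.Unary.Unique.Propositional using (Unique)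
open import Data.List.Relation.Unary.Unique.Propositional.Properties using (allFin⁺)
open import Data.List.Relation.Binary.Permutation.Propositional using (_↭_; ↭-sym; ↭⇒↭ₛ)
open import Data.List.Relation.Binary.Permutation.Propositional.Properties using (∈-resp-↭)
open import Data.List.Relation.Binary.Permutation.Setoid.Properties using (Unique-resp-↭)
open import Data.Product using (_×_; _,_; proj₁; proj₂; ∃-syntax)
open import Data.Sum using (_⊎_; inj₁; inj₂) renaming (map to ⊎-map)
open import Data.Empty using (⊥; ⊥-elim)
open import Function using (_∘_; id)
open import Relation.Unary using (Decidable)
open import Relation.Nullary using (¬_; Dec; yes; no; ¬?)
open import Relation.Nullary.Decidable using (map′; _×-dec_; _⊎-dec_; _→-dec_)
open import Relation.Binary.PropositionalEquality
open import Relation.Binary.Construct.Closure.ReflexiveTransitive using (Star; ε; _◅_)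
open import Relation.Binary.Construct.Closure.Transitive using ([_])

Star-exit : ∀ {A : Set} {R : A → A → Set} {P : A → Set} → Decidable P →
            ∀ {a b} → Star R a b → P a → ¬ P b → ∃[ x ] ∃[ y ] (R x y × P x × ¬ P y)
Star-exit P? ε pa ¬pb = ⊥-elim (¬pb pa)
Star-exit P? (_◅_ {j = c} r path) pa ¬pb with P? c
... | yes pc = Star-exit P? path pc ¬pb
... | no ¬pc = _ , _ , r , pa , ¬pc

module _ {A : Set} where

  Unique-++⁻ˡ : ∀ {xs ys : List A} → Unique (xs ++ ys) → Unique xs
  Unique-++⁻ˡ {[]}     _          = []
  Unique-++⁻ˡ {x ∷ xs} (x∉ ∷ xs!) = ++⁻ˡ xs x∉ ∷ Unique-++⁻ˡ xs!

  Unique-++⁻ʳ : ∀ xs {ys : List A} → Unique (xs ++ ys) → Unique ys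
  Unique-++⁻ʳ []       ys!        = ys!
  Unique-++⁻ʳ (x ∷ xs) (_ ∷ xs!)  = Unique-++⁻ʳ xs xs!

  Unique-++-disjoint : ∀ xs {ys : List A} {z} → Unique (xs ++ ys) → z ∈ xs → z ∉ ys
  Unique-++-disjoint (x ∷ xs) (x∉ ∷ _)   (here refl) z∈ys = All.lookup (++⁻ʳ xs x∉) z∈ys refl
  Unique-++-disjoint (x ∷ xs) (_ ∷ xs!) (there z∈xs) z∈ys = Unique-++-disjoint xs xs! z∈xs z∈ys

  lookup-++ : ∀ (xs ys : List A) k →
              (∃[ m ] lookup (xs ++ ys) k ≡ lookup xs m) ⊎ (∃[ j ] lookup (xs ++ ys) k ≡ lookup ys j)
  lookup-++ []       ys k       = inj₂ (k , refl)
  lookup-++ (x ∷ xs) ys zero    = inj₁ (zero , refl)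
  lookup-++ (x ∷ xs) ys (suc k) = ⊎-map (λ (m , e) → suc m , e) id (lookup-++ xs ys k)

  lookup-++ˡ : ∀ (xs ys : List A) m → ∃[ k ] lookup (xs ++ ys) k ≡ lookup xs m
  lookup-++ˡ (x ∷ xs) ys zero    = zero , refl
  lookup-++ˡ (x ∷ xs) ys (suc m) = let k , e = lookup-++ˡ xs ys m in suc k , e

  lookup-++ʳ : ∀ (xs ys : List A) j → ∃[ k ] lookup (xs ++ ys) k ≡ lookup ys j
  lookup-++ʳ []       ys j = j , refl
  lookup-++ʳ (x ∷ xs) ys j = let k , e = lookup-++ʳ xs ys j in suc k , e

module _ {n : ℕ} where

  ⪯-refl : ∀ {t : Tree {n}} (a : Pos t) → a ⪯ a
  ⪯-refl root       = ⪯root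
  ⪯-refl (down i a) = ⪯down (⪯-refl a)

  ⪯-trans : ∀ {t : Tree {n}} {a b c : Pos t} → a ⪯ b → b ⪯ c → a ⪯ c
  ⪯-trans _         ⪯root     = ⪯root
  ⪯-trans (⪯down p) (⪯down q) = ⪯down (⪯-trans p q)

  ⪯-linear : ∀ {t : Tree {n}} {a b c : Pos t} → a ⪯ b → a ⪯ c → b ⪯ c ⊎ c ⪯ b
  ⪯-linear _         ⪯root     = inj₁ ⪯root
  ⪯-linear ⪯root     (⪯down _) = inj₂ ⪯root
  ⪯-linear (⪯down p) (⪯down q) = ⊎-map ⪯down ⪯down (⪯-linear p q)

  _⪯?_ : ∀ {t : Tree {n}} (a b : Pos t) → Dec (a ⪯ b)
  a        ⪯? root     = yes ⪯root
  root     ⪯? down j b = no λ ()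
  down i a ⪯? down j b with i ≟ᶠ j
  ... | no i≢j   = no λ { (⪯down _) → i≢j refl }
  ... | yes refl = map′ ⪯down (λ { (⪯down p) → p }) (a ⪯? b)

  infixl 30 _⊔_
  _⊔_ : ∀ {t : Tree {n}} → Pos t → Pos t → Pos t
  root     ⊔ b        = root
  down i a ⊔ root     = root
  down i a ⊔ down j b with i ≟ᶠ j
  ... | yes refl = down i (a ⊔ b)
  ... | no _     = root

  a⪯a⊔b : ∀ {t : Tree {n}} (a b : Pos t) → a ⪯ a ⊔ b
  a⪯a⊔b root       b          = ⪯root
  a⪯a⊔b (down i a) root       = ⪯root
  a⪯a⊔b (down i a) (down j b) with i ≟ᶠ j
  ... | yes refl = ⪯down (a⪯a⊔b a b)
  ... | no _     = ⪯root

  b⪯a⊔b : ∀ {t : Tree {n}} (a b : Pos t) → b ⪯ a ⊔ b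
  b⪯a⊔b root       b          = ⪯root
  b⪯a⊔b (down i a) root       = ⪯root
  b⪯a⊔b (down i a) (down j b) with i ≟ᶠ j
  ... | yes refl = ⪯down (b⪯a⊔b a b)
  ... | no _     = ⪯root

  ⊔-lub : ∀ {t : Tree {n}} {a b c : Pos t} → a ⪯ c → b ⪯ c → a ⊔ b ⪯ c
  ⊔-lub {c = root} _ _ = ⪯root
  ⊔-lub (⪯down {i = i} p) (⪯down q) with i ≟ᶠ i
  ... | yes refl = ⪯down (⊔-lub p q)
  ... | no i≢i   = ⊥-elim (i≢i refl)

  cluster : (t : Tree {n}) → Pos t → List (Fin n)
  cluster t w = leaves (sub t w)

  ∈-leavesL : ∀ (ts : List (Tree {n})) i {x} → x ∈ leaves (lookup ts i) → x ∈ leavesL ts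
  ∈-leavesL (t ∷ ts) zero    x∈ = ∈-++⁺ˡ x∈
  ∈-leavesL (t ∷ ts) (suc i) x∈ = ∈-++⁺ʳ (leaves t) (∈-leavesL ts i x∈)

  cluster⊆leaves : ∀ (t : Tree {n}) (w : Pos t) {x} → x ∈ cluster t w → x ∈ leaves t
  cluster⊆leaves t         root       x∈ = x∈
  cluster⊆leaves (node ts) (down i w) x∈ = ∈-leavesL ts i (cluster⊆leaves (lookup ts i) w x∈)

  cluster-mono : ∀ {t : Tree {n}} {a b : Pos t} → a ⪯ b → ∀ {x} → x ∈ cluster t a → x ∈ cluster t b
  cluster-mono {t} {a} ⪯root x∈ = cluster⊆leaves t a x∈
  cluster-mono (⪯down a⪯b)  x∈ = cluster-mono a⪯b x∈

  sub≡leaf⇒∈cluster : ∀ (t : Tree {n}) p {x} → sub t p ≡ leaf x → x ∈ cluster t p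
  sub≡leaf⇒∈cluster t p e rewrite e = here refl

  mutual
    leafPosition : ∀ (t : Tree {n}) {x} → x ∈ leaves t → ∃[ p ] sub t p ≡ leaf x
    leafPosition (leaf y)  (here refl) = root , refl
    leafPosition (node ts) x∈          = let i , p , e = leafPositionL ts x∈ in down i p , e

    leafPositionL : ∀ (ts : List (Tree {n})) {x} → x ∈ leavesL ts →
                    ∃[ i ] ∃[ p ] sub (lookup ts i) p ≡ leaf x
    leafPositionL (t ∷ ts) x∈ with ∈-++⁻ (leaves t) x∈
    ... | inj₁ x∈t  = let p , e = leafPosition t x∈t in zero , p , e
    ... | inj₂ x∈ts = let i , p , e = leafPositionL ts x∈ts in suc i , p , e

  LeafBelow⇒∈cluster : ∀ {t : Tree {n}} {x w} → LeafBelow t x w → x ∈ cluster t w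
  LeafBelow⇒∈cluster (p , e , p⪯w) = cluster-mono p⪯w (sub≡leaf⇒∈cluster _ p e)

  ∈cluster⇒LeafBelow : ∀ (t : Tree {n}) (w : Pos t) {x} → x ∈ cluster t w → LeafBelow t x w
  ∈cluster⇒LeafBelow t root x∈ = let p , e = leafPosition t x∈ in p , e , ⪯root
  ∈cluster⇒LeafBelow (node ts) (down i w) x∈ =
    let p , e , p⪯w = ∈cluster⇒LeafBelow (lookup ts i) w x∈ in down i p , e , ⪯down p⪯w

  LeafBelow-resp-cluster : ∀ {t t' : Tree {n}} {w : Pos t} {w' : Pos t'} → cluster t w ≡ cluster t' w' →
                           ∀ {x} → LeafBelow t x w → LeafBelow t' x w'
  LeafBelow-resp-cluster {t' = t'} {w' = w'} e b =
    ∈cluster⇒LeafBelow t' w' (subst (_ ∈_) e (LeafBelow⇒∈cluster b))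

  LeafBelow-⪯ : ∀ {t : Tree {n}} {x a b} → LeafBelow t x a → a ⪯ b → LeafBelow t x b
  LeafBelow-⪯ (p , e , p⪯a) a⪯b = p , e , ⪯-trans p⪯a a⪯b

  Unique-child : ∀ (ts : List (Tree {n})) → Unique (leavesL ts) → ∀ i → Unique (leaves (lookup ts i))
  Unique-child (t ∷ ts) ts! zero    = Unique-++⁻ˡ ts!
  Unique-child (t ∷ ts) ts! (suc i) = Unique-child ts (Unique-++⁻ʳ (leaves t) ts!) i

  Unique-child-disjoint : ∀ (ts : List (Tree {n})) → Unique (leavesL ts) → ∀ i j {x} →
                          x ∈ leaves (lookup ts i) → x ∈ leaves (lookup ts j) → i ≡ j
  Unique-child-disjoint (t ∷ ts) ts! zero    zero    _  _  = refl
  Unique-child-disjoint (t ∷ ts) ts! zero    (suc j) x∈ y∈ =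
    ⊥-elim (Unique-++-disjoint (leaves t) ts! x∈ (∈-leavesL ts j y∈))
  Unique-child-disjoint (t ∷ ts) ts! (suc i) zero    x∈ y∈ =
    ⊥-elim (Unique-++-disjoint (leaves t) ts! y∈ (∈-leavesL ts i x∈))
  Unique-child-disjoint (t ∷ ts) ts! (suc i) (suc j) x∈ y∈ =
    cong suc (Unique-child-disjoint ts (Unique-++⁻ʳ (leaves t) ts!) i j x∈ y∈)

  leafPosition-unique : ∀ {t : Tree {n}} → Unique (leaves t) → ∀ {p q : Pos t} {x} →
                        sub t p ≡ leaf x → sub t q ≡ leaf x → p ≡ q
  leafPosition-unique _ {root}     {root}     _  _  = refl
  leafPosition-unique _ {root}     {down _ _} () _
  leafPosition-unique _ {down _ _} {root}     _  ()
  leafPosition-unique {node ts} ts! {down i p} {down j q} e e'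
    with Unique-child-disjoint ts ts! i j (cluster⊆leaves _ p (sub≡leaf⇒∈cluster _ p e))
                                          (cluster⊆leaves _ q (sub≡leaf⇒∈cluster _ q e'))
  ... | refl = cong (down i) (leafPosition-unique (Unique-child ts ts! i) e e')

  -- the second clause of condition (a) is  ∀ z → σ z ≡ σ y → BelowLca t x z y
  BelowLca : Tree {n} → Fin n → Fin n → Fin n → Set
  BelowLca t x z y = ∃[ v ] (IsLca t x z v × LeafBelow t y v)

  BelowCommonAncestors : Tree {n} → Fin n → Fin n → Fin n → Set
  BelowCommonAncestors t x z y = ∀ w → LeafBelow t x w → LeafBelow t z w → LeafBelow t y w

  BelowLca⇒BelowCommonAncestors : ∀ {t x z y} → BelowLca t x z y → BelowCommonAncestors t x z y
  BelowLca⇒BelowCommonAncestors (v , (_ , _ , least) , y≤v) w x≤w z≤w = LeafBelow-⪯ y≤v (least w x≤w z≤w)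

  isNode? : (t : Tree {n}) → Dec (IsNode t)
  isNode? (leaf x)  = no λ ()
  isNode? (node ts) = yes (ts , refl)

  LeafSetIs⇒Unique : ∀ (t : Tree {n}) → LeafSetIs t → Unique (leaves t)
  LeafSetIs⇒Unique t ls = Unique-resp-↭ (setoid (Fin n)) (↭⇒↭ₛ (↭-sym ls)) (allFin⁺ n)

  LeafSetIs⇒∈leaves : ∀ (t : Tree {n}) → LeafSetIs t → ∀ x → x ∈ leaves t
  LeafSetIs⇒∈leaves t ls x = ∈-resp-↭ (↭-sym ls) (∈-allFin x)

  -- Each label marks exactly one leaf, so "x lies below w" is just "leafPos x ⪯ w".
  module Labelled {t : Tree {n}} (ls : LeafSetIs t) where

    leafPos : Fin n → Pos t
    leafPos x = proj₁ (leafPosition t (LeafSetIs⇒∈leaves t ls x))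

    sub-leafPos : ∀ x → sub t (leafPos x) ≡ leaf x
    sub-leafPos x = proj₂ (leafPosition t (LeafSetIs⇒∈leaves t ls x))

    LeafBelow⇒⪯ : ∀ {x w} → LeafBelow t x w → leafPos x ⪯ w
    LeafBelow⇒⪯ {x} (p , e , p⪯w) =
      subst (_⪯ _) (leafPosition-unique (LeafSetIs⇒Unique t ls) e (sub-leafPos x)) p⪯w

    ⪯⇒LeafBelow : ∀ {x w} → leafPos x ⪯ w → LeafBelow t x w
    ⪯⇒LeafBelow {x} le = leafPos x , sub-leafPos x , le

    lca : Fin n → Fin n → Pos t
    lca x z = leafPos x ⊔ leafPos z

    below-lcaˡ : ∀ x z → LeafBelow t x (lca x z)
    below-lcaˡ x z = ⪯⇒LeafBelow (a⪯a⊔b (leafPos x) (leafPos z))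

    below-lcaʳ : ∀ x z → LeafBelow t z (lca x z)
    below-lcaʳ x z = ⪯⇒LeafBelow (b⪯a⊔b (leafPos x) (leafPos z))

    lca-least : ∀ x z w → LeafBelow t x w → LeafBelow t z w → lca x z ⪯ w
    lca-least x z w x≤w z≤w = ⊔-lub (LeafBelow⇒⪯ x≤w) (LeafBelow⇒⪯ z≤w)

    isLca : ∀ x z → IsLca t x z (lca x z)
    isLca x z = below-lcaˡ x z , below-lcaʳ x z , lca-least x z

    leafBelow? : ∀ x w → Dec (LeafBelow t x w)
    leafBelow? x w = map′ ⪯⇒LeafBelow LeafBelow⇒⪯ (leafPos x ⪯? w)

    isLca? : ∀ x z v → Dec (IsLca t x z v)
    isLca? x z v = map′
      (λ (x≤v , z≤v , v⪯lca) → x≤v , z≤v , λ w x≤w z≤w → ⪯-trans v⪯lca (lca-least x z w x≤w z≤w))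
      (λ (x≤v , z≤v , least) → x≤v , z≤v , least (lca x z) (below-lcaˡ x z) (below-lcaʳ x z))
      (leafBelow? x v ×-dec leafBelow? z v ×-dec v ⪯? lca x z)

    belowLca? : ∀ x z y → Dec (BelowLca t x z y)
    belowLca? x z y = map′ (λ y≤lca → lca x z , isLca x z , y≤lca)
      (λ b → BelowLca⇒BelowCommonAncestors b (lca x z) (below-lcaˡ x z) (below-lcaʳ x z))
      (leafBelow? y (lca x z))

    BelowCommonAncestors⇒BelowLca : ∀ {x z y} → BelowCommonAncestors t x z y → BelowLca t x z y
    BelowCommonAncestors⇒BelowLca {x} {z} below =
      lca x z , isLca x z , below (lca x z) (below-lcaˡ x z) (below-lcaʳ x z)

    condA? : ∀ σ u x y → Dec (CondA t σ u x y)
    condA? σ u x y = ((u x ≟ᵇ true) ×-dec isNode? t)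
                     ×-dec all? (λ z → (σ z ≟ᵇ σ y) →-dec belowLca? x z y)

    module _ {σ u : Fin n → Bool} {E : Fin n → Fin n → Set} (expl : Explains t σ u E) where

      edge? : ∀ x y → Dec (E x y)
      edge? x y = map′ (proj₂ (expl x y)) (proj₁ (expl x y))
                       (¬? (σ x ≟ᵇ σ y) ×-dec (condA? σ u x y ⊎-dec condA? σ u y x))

      lcaEdge? : ∀ v → Dec (∃[ x ] ∃[ y ] (E x y × IsLca t x y v))
      lcaEdge? v = any? λ x → any? λ y → edge? x y ×-dec isLca? x y v

  open DecMembership (_≟ᶠ_ {n}) using (_∈?_)

  Phylo⇒leaf : ∀ {t : Tree {n}} → Phylo t → ∃[ x ] x ∈ leaves t
  Phylo⇒leaf (leafP {x})                      = x , here refl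
  Phylo⇒leaf (nodeP {t ∷ ts} _ (t-phylo ∷ _)) =
    let x , x∈ = Phylo⇒leaf t-phylo in x , ∈-++⁺ˡ x∈

  isLca-root-of-separated : ∀ {ts : List (Tree {n})} → Unique (leavesL ts) → ∀ i {x y} →
                            x ∈ leaves (lookup ts i) → y ∈ leavesL ts → y ∉ leaves (lookup ts i) →
                            IsLca (node ts) x y root
  isLca-root-of-separated {ts} ts! i {x} {y} x∈i y∈ y∉i =
    ∈cluster⇒LeafBelow (node ts) root (∈-leavesL ts i x∈i) ,
    ∈cluster⇒LeafBelow (node ts) root y∈ ,
    least
    where
    least : ∀ w → LeafBelow (node ts) x w → LeafBelow (node ts) y w → root ⪯ w
    least root       _   _   = ⪯root
    least (down k w) x≤w y≤w
      with Unique-child-disjoint ts ts! k i (cluster⊆leaves _ w (LeafBelow⇒∈cluster x≤w)) x∈i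
    ... | refl = ⊥-elim (y∉i (cluster⊆leaves _ w (LeafBelow⇒∈cluster y≤w)))

  root-lcaEdge : ∀ {ts : List (Tree {n})} {E : Fin n → Fin n → Set} →
                 Phylo (node ts) → LeafSetIs (node ts) → Connected E →
                 ∃[ x ] ∃[ y ] (E x y × IsLca (node ts) x y root)
  root-lcaEdge (nodeP (s≤s ()) (_ ∷ []))
  root-lcaEdge {t₀ ∷ t₁ ∷ ts} (nodeP _ (t₀-phylo ∷ t₁-phylo ∷ _)) ls conn =
    let a , a∈t₀ = Phylo⇒leaf t₀-phylo
        b , b∈t₁ = Phylo⇒leaf t₁-phylo
        b∉t₀ b∈t₀ = 0≢1+n (Unique-child-disjoint children ts! zero (suc zero) b∈t₀ b∈t₁)
        x , y , exy , x∈t₀ , y∉t₀ = Star-exit (_∈? leaves t₀) (conn a b) a∈t₀ b∉t₀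
    in x , y , exy , isLca-root-of-separated ts! zero x∈t₀ (LeafSetIs⇒∈leaves (node children) ls y) y∉t₀
    where
    children = t₀ ∷ t₁ ∷ ts
    ts! = LeafSetIs⇒Unique (node children) ls

  -- In node ts, contract the arc into the vertex p of the i-th child (no-op if that vertex is a leaf).
  contractArc : (ts : List (Tree {n})) (i : Fin (length ts)) → Pos (lookup ts i) → List (Tree {n})
  contractArc (t       ∷ ts) (suc i) p          = t ∷ contractArc ts i p
  contractArc (leaf x  ∷ ts) zero    root       = leaf x ∷ ts
  contractArc (node cs ∷ ts) zero    root       = cs ++ ts
  contractArc (node cs ∷ ts) zero    (down j p) = node (contractArc cs j p) ∷ ts

  leavesL-++ : ∀ (xs ys : List (Tree {n})) → leavesL (xs ++ ys) ≡ leavesL xs ++ leavesL ys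
  leavesL-++ []       ys = refl
  leavesL-++ (x ∷ xs) ys = trans (cong (leaves x ++_) (leavesL-++ xs ys)) (sym (++-assoc (leaves x) _ _))

  leavesL-contractArc : ∀ ts i p → leavesL (contractArc ts i p) ≡ leavesL ts
  leavesL-contractArc (leaf x  ∷ ts) zero    root       = refl
  leavesL-contractArc (node cs ∷ ts) zero    root       = leavesL-++ cs ts
  leavesL-contractArc (node cs ∷ ts) zero    (down j p) = cong (_++ leavesL ts) (leavesL-contractArc cs j p)
  leavesL-contractArc (t       ∷ ts) (suc i) p          = cong (leaves t ++_) (leavesL-contractArc ts i p)

  Contract1-∷ : ∀ {t} {ts ts' : List (Tree {n})} → Contract1 (node ts) (node ts') →
                Contract1 (node (t ∷ ts)) (node (t ∷ ts'))
  Contract1-∷ (contrHere s) = contrHere (spliceThere s)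
  Contract1-∷ (contrDeep c) = contrDeep (inThere c)

  contractArc-Contract1 : ∀ ts i p → IsNode (sub (lookup ts i) p) →
                          Contract1 (node ts) (node (contractArc ts i p))
  contractArc-Contract1 (leaf x  ∷ ts) zero    root       ()
  contractArc-Contract1 (node cs ∷ ts) zero    root       _  = contrHere spliceHere
  contractArc-Contract1 (node cs ∷ ts) zero    (down j p) p-node =
    contrDeep (inHere (contractArc-Contract1 cs j p p-node))
  contractArc-Contract1 (t       ∷ ts) (suc i) p          p-node =
    Contract1-∷ (contractArc-Contract1 ts i p p-node)

  ChildCluster : List (Tree {n}) → List (Fin n) → Set
  ChildCluster ts c = ∃[ j ] ∃[ q ] cluster (lookup ts j) q ≡ c

  Pos-subst : ∀ {a b : Tree {n}} → a ≡ b → (q : Pos a) → ∃[ q' ] cluster b q' ≡ cluster a q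
  Pos-subst refl q = q , refl

  lookup-cluster : ∀ (ts : List (Tree {n})) {a} k → lookup ts k ≡ a → (q : Pos a) →
                   ChildCluster ts (cluster a q)
  lookup-cluster ts k e q = k , Pos-subst (sym e) q

  -- Contracting the arc into v removes exactly the cluster of v.
  mutual
    contractArc-cluster⁻ : ∀ ts i p (w' : Pos (node (contractArc ts i p))) →
                           ∃[ w ] cluster (node ts) w ≡ cluster _ w'
    contractArc-cluster⁻ ts i p root       = root , sym (leavesL-contractArc ts i p)
    contractArc-cluster⁻ ts i p (down k q) =
      let j , q' , e = contractArcL-cluster⁻ ts i p k q in down j q' , e

    contractArcL-cluster⁻ : ∀ ts i p k (q : Pos (lookup (contractArc ts i p) k)) →
                            ChildCluster ts (cluster _ q)
    contractArcL-cluster⁻ (leaf x  ∷ ts) zero    root       k       q = k , q , refl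
    contractArcL-cluster⁻ (node cs ∷ ts) zero    root       k       q with lookup-++ cs ts k
    ... | inj₁ (m , e) = let q' , e' = Pos-subst e q in zero , down m q' , e'
    ... | inj₂ (j , e) = let q' , e' = Pos-subst e q in suc j , q' , e'
    contractArcL-cluster⁻ (node cs ∷ ts) zero    (down j p) zero    q =
      let w , e = contractArc-cluster⁻ cs j p q in zero , w , e
    contractArcL-cluster⁻ (node cs ∷ ts) zero    (down j p) (suc k) q = suc k , q , refl
    contractArcL-cluster⁻ (t       ∷ ts) (suc i) p          zero    q = zero , q , refl
    contractArcL-cluster⁻ (t       ∷ ts) (suc i) p          (suc k) q =
      let j , q' , e = contractArcL-cluster⁻ ts i p k q in suc j , q' , e

  mutual
    contractArc-cluster⁺ : ∀ ts i p (w : Pos (node ts)) →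
                           w ≡ down i p ⊎ ∃[ w' ] cluster (node (contractArc ts i p)) w' ≡ cluster _ w
    contractArc-cluster⁺ ts i p root       = inj₂ (root , leavesL-contractArc ts i p)
    contractArc-cluster⁺ ts i p (down j q) with contractArcL-cluster⁺ ts i p j q
    ... | inj₁ refl          = inj₁ refl
    ... | inj₂ (k , q' , e) = inj₂ (down k q' , e)

    contractArcL-cluster⁺ : ∀ ts i p j (q : Pos (lookup ts j)) →
                            down {ts = ts} j q ≡ down i p ⊎ ChildCluster (contractArc ts i p) (cluster _ q)
    contractArcL-cluster⁺ (t       ∷ ts) zero    root       zero    root       = inj₁ refl
    contractArcL-cluster⁺ (node cs ∷ ts) zero    root       zero    (down m q) =
      let k , e = lookup-++ˡ cs ts m in inj₂ (lookup-cluster (cs ++ ts) k e q)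
    contractArcL-cluster⁺ (leaf x  ∷ ts) zero    root       (suc j) q = inj₂ (suc j , q , refl)
    contractArcL-cluster⁺ (node cs ∷ ts) zero    root       (suc j) q =
      let k , e = lookup-++ʳ cs ts j in inj₂ (lookup-cluster (cs ++ ts) k e q)
    contractArcL-cluster⁺ (node cs ∷ ts) zero    (down m p) zero    q with contractArc-cluster⁺ cs m p q
    ... | inj₁ refl     = inj₁ refl
    ... | inj₂ (w' , e) = inj₂ (zero , w' , e)
    contractArcL-cluster⁺ (node cs ∷ ts) zero    (down m p) (suc j) q = inj₂ (suc j , q , refl)
    contractArcL-cluster⁺ (t       ∷ ts) (suc i) p          zero    q = inj₂ (zero , q , refl)
    contractArcL-cluster⁺ (t       ∷ ts) (suc i) p          (suc j) q
      with contractArcL-cluster⁺ ts i p j q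
    ... | inj₁ refl          = inj₁ refl
    ... | inj₂ (k , q' , e) = inj₂ (suc k , q' , e)

  BelowCommonAncestors-contract⁺ : ∀ ts i p {x z y} → BelowCommonAncestors (node ts) x z y →
                                   BelowCommonAncestors (node (contractArc ts i p)) x z y
  BelowCommonAncestors-contract⁺ ts i p below w' x≤w' z≤w' =
    let w , e = contractArc-cluster⁻ ts i p w'
    in LeafBelow-resp-cluster e
         (below w (LeafBelow-resp-cluster (sym e) x≤w') (LeafBelow-resp-cluster (sym e) z≤w'))

  BelowCommonAncestors-contract⁻ : ∀ ts i p {x z y} → BelowCommonAncestors (node (contractArc ts i p)) x z y →
                                   ∀ w → LeafBelow (node ts) x w → LeafBelow (node ts) z w →
                                   w ≡ down i p ⊎ LeafBelow (node ts) y w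
  BelowCommonAncestors-contract⁻ ts i p below w x≤w z≤w with contractArc-cluster⁺ ts i p w
  ... | inj₁ w≡v     = inj₁ w≡v
  ... | inj₂ (w' , e) = inj₂ (LeafBelow-resp-cluster e
                          (below w' (LeafBelow-resp-cluster (sym e) x≤w) (LeafBelow-resp-cluster (sym e) z≤w)))

  module ContractedExplains (ts : List (Tree {n})) (i : Fin (length ts)) (p : Pos (lookup ts i))
           {σ u : Fin n → Bool} {E : Fin n → Fin n → Set}
           (ls : LeafSetIs (node ts)) (expl : Explains (node ts) σ u E)
           (no-lcaEdge : ¬ (∃[ x ] ∃[ y ] (E x y × IsLca (node ts) x y (down i p)))) where

    private
      t t' : Tree {n}
      t  = node ts
      t' = node (contractArc ts i p)

      v : Pos t
      v = down i p

      ls' : LeafSetIs t'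
      ls' = subst (_↭ allFin n) (sym (leavesL-contractArc ts i p)) ls

    open Labelled {t} ls
    open Labelled {t'} ls' using ()
      renaming (BelowCommonAncestors⇒BelowLca to BelowCommonAncestors⇒BelowLca')

    condA⁺ : ∀ {x y} → CondA t σ u x y → CondA t' σ u x y
    condA⁺ ((ux , _) , below) = (ux , (_ , refl)) ,
      λ z σz≡σy → BelowCommonAncestors⇒BelowLca'
                    (BelowCommonAncestors-contract⁺ ts i p (BelowLca⇒BelowCommonAncestors (below z σz≡σy)))

    below-except-v : ∀ {x y} → CondA t' σ u x y → ∀ z → σ z ≡ σ y →
                     ∀ w → LeafBelow t x w → LeafBelow t z w → w ≡ v ⊎ LeafBelow t y w
    below-except-v condA' z σz≡σy =
      BelowCommonAncestors-contract⁻ ts i p (BelowLca⇒BelowCommonAncestors (proj₂ condA' z σz≡σy))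

    -- If x is below v but y is not, condition (a) for (x, y) in t' makes every z of y's colour below v
    -- adjacent to x with lca(x, z) = v.
    module _ {x y} (σx≢σy : σ x ≢ σ y) (condA' : CondA t' σ u x y)
             (x≤v : LeafBelow t x v) (y≰v : ¬ LeafBelow t y v) where

      v-least : ∀ z → σ z ≡ σ y → ∀ w → LeafBelow t x w → LeafBelow t z w → v ⪯ w
      v-least z σz≡σy w x≤w z≤w with below-except-v condA' z σz≡σy w x≤w z≤w
      ... | inj₁ refl = ⪯-refl v
      ... | inj₂ y≤w with ⪯-linear (LeafBelow⇒⪯ x≤v) (LeafBelow⇒⪯ x≤w)
      ...   | inj₁ v⪯w = v⪯w
      ...   | inj₂ w⪯v = ⊥-elim (y≰v (LeafBelow-⪯ y≤w w⪯v))

      lcaEdge-at-v : ∀ z → σ z ≡ σ y → LeafBelow t z v → E x z × IsLca t x z v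
      lcaEdge-at-v z σz≡σy z≤v = edge , x≤v , z≤v , v-least z σz≡σy
        where
        below : ∀ z' → σ z' ≡ σ z → BelowLca t x z' z
        below z' σz'≡σz = BelowCommonAncestors⇒BelowLca
          λ w x≤w z'≤w → LeafBelow-⪯ z≤v (v-least z' (trans σz'≡σz σz≡σy) w x≤w z'≤w)

        edge : E x z
        edge = proj₂ (expl x z) ((λ σx≡σz → σx≢σy (trans σx≡σz σz≡σy)) ,
                                 inj₁ ((proj₁ (proj₁ condA') , (ts , refl)) , below))

    condA⁻ : ∀ {x y} → σ x ≢ σ y → CondA t' σ u x y → CondA t σ u x y
    condA⁻ {x} {y} σx≢σy condA' = (proj₁ (proj₁ condA') , (ts , refl)) ,
      λ z σz≡σy → BelowCommonAncestors⇒BelowLca (below z σz≡σy)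
      where
      below : ∀ z → σ z ≡ σ y → BelowCommonAncestors t x z y
      below z σz≡σy w x≤w z≤w with below-except-v condA' z σz≡σy w x≤w z≤w
      ... | inj₂ y≤w = y≤w
      ... | inj₁ refl with leafBelow? y v
      ...   | yes y≤v = y≤v
      ...   | no y≰v  = ⊥-elim (no-lcaEdge (x , z , lcaEdge-at-v σx≢σy condA' x≤w y≰v z σz≡σy z≤w))

    explains : Explains t' σ u E
    explains x y =
      (λ exy → let σx≢σy , cond = proj₁ (expl x y) exy in σx≢σy , ⊎-map condA⁺ condA⁺ cond) ,
      (λ (σx≢σy , cond) →
         proj₂ (expl x y) (σx≢σy , ⊎-map (condA⁻ σx≢σy) (condA⁻ (σx≢σy ∘ sym)) cond))

proposition3p4 : (n : ℕ) (t : Tree {n}) (σ u : Fin n → Bool) (E : Fin n → Fin n → Set) →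
    Phylo t → LeafSetIs t → Explains t σ u E → Connected E → LeastResolved t σ E →
    ∀ (v : Pos t) → IsNode (sub t v) → ∃[ x ] ∃[ y ] (E x y × IsLca t x y v)
proposition3p4 _ _ _ _ _ phylo ls _ conn _ root (_ , refl) = root-lcaEdge phylo ls conn
proposition3p4 _ (node ts) _ u _ _ ls expl _ least-resolved (down i p) v-internal
  with Labelled.lcaEdge? {t = node ts} ls expl (down i p)
... | yes lcaEdge   = lcaEdge
... | no no-lcaEdge = ⊥-elim (least-resolved
        (_ , u , [ contractArc-Contract1 ts i p v-internal ] ,
         ContractedExplains.explains ts i p ls expl no-lcaEdge))
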